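{- Let $n\ge1$. For each simplex $\sigma\in\mathcal S_n$ there exist a permutation $p$ of $\{1,\dots,n\}$ and functions $e\colon\{0,\dots,n\}\to\{\le,=\}$ and $s\colon\{1,\dots,n\}\to\{ -,+\}$ such that $\sigma$ is the set of solutions $(x_1,\dots,x_n)\in[0,1]^n$ of the system $$\tfrac12\ e(0)\ x_{p(1)}^{s(1)},\qquad x_{p(i)}^{s(i)}\ e(i)\ x_{p(i+1)}^{s(i+1)}\ (i=1,\dots,n-1),\qquad x_{p(n)}^{s(n)}\ e(n)\ 1,$$ where $x_i^{+}=x_i$ and $x_i^{ - }=1-x_i$. In particular, if $f\in\mathcal M_n$ lies in the Kleene subalgebra of $\mathcal M_n$ generated by $\pi_1,\dots,\pi_n,0,1$, then over $\sigma$ either $f$ is constantly $0$, or constantly $1$, or there is $i\in\{1,\dots,n\}$ such that $f$ coincides over $\sigma$ with $\pi_i$ or with $1-\pi_i$.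
   Context: On $\{0,\tfrac12,1\}$ let $\preceq$ be the partial order with $\tfrac12\preceq0$, $\tfrac12\preceq1$, and $0,1$ incomparable; $\preceq_n$ is the componentwise order on $\{0,\tfrac12,1\}^n$. The Kleene triangulation of $[0,1]^n$ is $\mathcal S_n=\{\mathrm{conv}\,C: C\subseteq\{0,\tfrac12,1\}^n\text{ a chain of }(\{0,\tfrac12,1\}^n,\preceq_n)\}$, a rational triangulation of $[0,1]^n$ (each $\mathrm{conv}\,C$ is a simplex with vertex set $C$). $\mathcal M_n$ is the MV-algebra of $\mathbb Z$-maps $[0,1]^n\to[0,1]$ (continuous piecewise linear with finitely many affine pieces with integer coefficients); as a Kleene algebra its operations are $\max$, $\min$, $f\mapsto1-f$, and the constants $0,1$. $\pi_i$ is the $i$-th coordinate projection on $[0,1]^n$.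
   Formalization: Only points of $[0,1]^n$ with rational coordinates are considered, both in σ and in the solution set of the system and where f is compared with 0, 1, π_i or 1−π_i. -}

module Defs where

open import Data.Nat using (ℕ; zero; suc)
open import Data.Fin using (Fin; zero; suc; inject₁; fromℕ)
open import Data.List using (List; length; lookup)
open import Data.Rational using (ℚ; 0ℚ; 1ℚ; ½; _+_; _*_; _-_; _≤_; _⊔_; _⊓_)
open import Data.Product using (Σ; _×_; ∃)
open import Data.Sum using (_⊎_)
open import Relation.Binary.PropositionalEquality using (_≡_)
open import Data.Fin.Permutation using (Permutation′; _⟨$⟩ʳ_)

data K3 : Set where
  k0 kh k1 : K3

data _≼_ : K3 → K3 → Set where
  ≼-refl : ∀ {a} → a ≼ a
  ≼-half : ∀ {a} → kh ≼ a

toℚ : K3 → ℚ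
toℚ k0 = 0ℚ
toℚ kh = ½
toℚ k1 = 1ℚ

Vertex : ℕ → Set
Vertex n = Fin n → K3

_≼ₙ_ : ∀ {n} → Vertex n → Vertex n → Set
u ≼ₙ v = ∀ i → u i ≼ v i

IsChain : ∀ {n} → List (Vertex n) → Set
IsChain C = ∀ j k → (lookup C j ≼ₙ lookup C k) ⊎ (lookup C k ≼ₙ lookup C j)

Point : ℕ → Set
Point n = Fin n → ℚ

sumFin : ∀ {k} → (Fin k → ℚ) → ℚ
sumFin {zero}  f = 0ℚ
sumFin {suc k} f = f zero + sumFin (λ j → f (suc j))

InConv : ∀ {n} → List (Vertex n) → Point n → Set
InConv C x = Σ (Fin (length C) → ℚ) λ λs →
  (∀ j → 0ℚ ≤ λs j) × (sumFin λs ≡ 1ℚ) ×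
  (∀ i → x i ≡ sumFin (λ j → λs j * toℚ (lookup C j i)))

InCube : ∀ {n} → Point n → Set
InCube x = ∀ i → (0ℚ ≤ x i) × (x i ≤ 1ℚ)

data Rel : Set where
  le eq : Rel

data Sign : Set where
  minus plus : Sign

holds : Rel → ℚ → ℚ → Set
holds le a b = a ≤ b
holds eq a b = a ≡ b

lit : Sign → ℚ → ℚ
lit plus  a = a
lit minus a = 1ℚ - a

-- the system, for n = suc m, with 0-based indices:
--   ½ e(0) x_{p(0)}^{s(0)},
--   x_{p(i)}^{s(i)} e(i+1) x_{p(i+1)}^{s(i+1)}  (i = 0..m-1),
--   x_{p(m)}^{s(m)} e(m+1) 1
System : ∀ {m} → Permutation′ (suc m) → (Fin (suc (suc m)) → Rel) → (Fin (suc m) → Sign) →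
         Point (suc m) → Set
System {m} p e s x =
  holds (e zero) ½ (y zero) ×
  (∀ (i : Fin m) → holds (e (suc (inject₁ i))) (y (inject₁ i)) (y (suc i))) ×
  holds (e (fromℕ (suc m))) (y (fromℕ m)) 1ℚ
  where
  y : Fin (suc m) → ℚ
  y k = lit (s k) (x (p ⟨$⟩ʳ k))

data KTerm (n : ℕ) : Set where
  proj : Fin n → KTerm n
  zeroT oneT : KTerm n
  maxT minT : KTerm n → KTerm n → KTerm n
  negT : KTerm n → KTerm n

eval : ∀ {n} → KTerm n → Point n → ℚ
eval (proj i)  x = x i
eval zeroT     x = 0ℚ
eval oneT      x = 1ℚ
eval (maxT a b) x = eval a x ⊔ eval b x
eval (minT a b) x = eval a x ⊓ eval b x
eval (negT a)  x = 1ℚ - eval a x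

{-# OPTIONS --safe #-}
-- Call a vertex coordinate sharp if it is 0 or 1. Since C is a chain, the sets of vertices
-- that are sharp at a coordinate are nested, so the coordinates can be ordered so that these
-- sets increase; and no coordinate is 0 at one vertex and 1 at another, so after replacing
-- x_i by 1 - x_i wherever some vertex is 0, every vertex becomes a step sequence: ½ before
-- its rank and 1 from its rank on. A convex combination of the vertices is then exactly a
-- sequence ½ ≤ y₀ ≤ ⋯ ≤ y_m ≤ 1 whose jumps occur only at ranks of vertices, which is the
-- system (conversely the jumps give the convex weights). On the simplex the literals
-- 0 ≤ 1 - y_m ≤ ⋯ ≤ 1 - y₀ ≤ y₀ ≤ ⋯ ≤ y_m ≤ 1 are therefore ordered independently of the
-- point, and they are closed under 1 - _, so max, min and negation map literals to literals.
module Submission where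

open import Defs
open import Data.Nat using (ℕ; zero; suc; z≤n; s≤s; s≤s⁻¹)
import Data.Nat as ℕ
import Data.Nat.Properties as ℕ
open import Data.Fin using (Fin; zero; suc; toℕ; inject₁; fromℕ; punchIn)
import Data.Fin as Fin
import Data.Fin.Properties as Fin
open import Data.Fin.Properties using (any?)
open import Data.Fin.Permutation using (Permutation′; _⟨$⟩ʳ_; _⟨$⟩ˡ_; inverseʳ; insert; insert-punchIn)
import Data.Fin.Permutation as Permutation
open import Data.List using (List; length; lookup)
open import Data.Rational using (ℚ; 0ℚ; 1ℚ; ½; _+_; _*_; _-_; -_; _≤_; _⊔_; _⊓_; nonNegative)
import Data.Rational.Properties as ℚ
open import Data.Rational.Solver using (module +-*-Solver)
open import Data.Product using (Σ; _×_; ∃; _,_; proj₁; proj₂)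
open import Data.Sum using (_⊎_; inj₁; inj₂)
import Data.Sum as Sum
open import Data.Empty using (⊥; ⊥-elim)
open import Data.Vec.Functional using (updateAt; _∷_)
open import Data.Vec.Functional.Properties using (updateAt-updates; updateAt-minimal)
open import Function using (_∘_)
open import Function.Bundles using (_⇔_; mk⇔; Equivalence)
open import Relation.Binary.Definitions using (Total; Transitive; DecidableEquality)
open import Relation.Nullary using (Dec; yes; no; ¬_)
open import Relation.Nullary.Decidable using (¬?; _×-dec_)
open import Relation.Unary using (Decidable)
open import Relation.Binary.PropositionalEquality
  using (_≡_; _≢_; refl; sym; trans; cong; cong₂; subst; subst₂; module ≡-Reasoning)

open +-*-Solver using (solve; _:=_; con; _:+_; _:*_; _:-_)
open Equivalence using (to; from)

0≤½ : 0ℚ ≤ ½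
0≤½ = ℚ.nonNegative⁻¹ ½

½≤1 : ½ ≤ 1ℚ
½≤1 = ℚ.≤ᵇ⇒≤ _

0≤q-p : ∀ {p q} → p ≤ q → 0ℚ ≤ q - p
0≤q-p {p} {q} p≤q = subst (_≤ q - p) (ℚ.+-inverseʳ p) (ℚ.+-monoˡ-≤ (- p) p≤q)

1-antimono : ∀ {p q} → p ≤ q → 1ℚ - q ≤ 1ℚ - p
1-antimono p≤q = ℚ.+-monoʳ-≤ 1ℚ (ℚ.neg-antimono-≤ p≤q)

½+½*-mono : ∀ {p q} → p ≤ q → ½ + ½ * p ≤ ½ + ½ * q
½+½*-mono p≤q = ℚ.+-monoʳ-≤ ½ (ℚ.*-monoˡ-≤-nonNeg ½ p≤q)

lit-involutive : ∀ σ q → lit σ (lit σ q) ≡ q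
lit-involutive plus  q = refl
lit-involutive minus q = solve 1 (λ q → con 1ℚ :- (con 1ℚ :- q) := q) refl q

lit-injective : ∀ σ {p q} → lit σ p ≡ lit σ q → p ≡ q
lit-injective σ {p} {q} lit≡ =
  trans (sym (lit-involutive σ p)) (trans (cong (lit σ) lit≡) (lit-involutive σ q))

lit-half : ∀ σ → lit σ ½ ≡ ½
lit-half plus  = refl
lit-half minus = refl

lit-unit-interval : ∀ σ {q} → ½ ≤ q → q ≤ 1ℚ → 0ℚ ≤ lit σ q × lit σ q ≤ 1ℚ
lit-unit-interval plus  ½≤q q≤1 = ℚ.≤-trans 0≤½ ½≤q , q≤1
lit-unit-interval minus ½≤q q≤1 = 0≤q-p q≤1 , ℚ.≤-trans (1-antimono ½≤q) ½≤1

holds-cong : ∀ r {p p′ q q′} → p ≡ p′ → q ≡ q′ → holds r p q → holds r p′ q′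
holds-cong r = subst₂ (holds r)

holds⇒≤ : ∀ r {p q} → holds r p q → p ≤ q
holds⇒≤ le p≤q = p≤q
holds⇒≤ eq p≡q = ℚ.≤-reflexive p≡q

relationFor : ∀ {P : Set} → Dec P → Rel
relationFor (yes _) = le
relationFor (no _)  = eq

holds-relationFor : ∀ {P : Set} (P? : Dec P) {p q} → (P → p ≤ q) → (¬ P → p ≡ q) →
                    holds (relationFor P?) p q
holds-relationFor (yes x) ≤-case _ = ≤-case x
holds-relationFor (no ¬x) _ ≡-case = ≡-case ¬x

relationFor-flat : ∀ {P : Set} (P? : Dec P) {p q} → ¬ P → holds (relationFor P?) p q → p ≡ q
relationFor-flat (yes x) ¬x _   = ⊥-elim (¬x x)
relationFor-flat (no _)  _  p≡q = p≡q

signFor : ∀ {P : Set} → Dec P → Sign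
signFor (yes _) = minus
signFor (no _)  = plus

weightedSum : ∀ {L} → (Fin L → ℚ) → (Fin L → ℚ) → ℚ
weightedSum μ c = sumFin (λ j → μ j * c j)

weightedSum-cong : ∀ {L} (μ : Fin L → ℚ) {c c′ : Fin L → ℚ} → (∀ j → c j ≡ c′ j) →
                   weightedSum μ c ≡ weightedSum μ c′
weightedSum-cong {zero}  μ c≡c′ = refl
weightedSum-cong {suc L} μ c≡c′ =
  cong₂ _+_ (cong (μ zero *_) (c≡c′ zero)) (weightedSum-cong (μ ∘ suc) (c≡c′ ∘ suc))

weightedSum-mono : ∀ {L} {μ c c′ : Fin L → ℚ} → (∀ j → 0ℚ ≤ μ j) → (∀ j → c j ≤ c′ j) →
                   weightedSum μ c ≤ weightedSum μ c′
weightedSum-mono {zero}          _   _     = ℚ.≤-refl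
weightedSum-mono {suc L} {μ} μ≥0 c≤c′ =
  ℚ.+-mono-≤ (ℚ.*-monoˡ-≤-nonNeg (μ zero) {{nonNegative (μ≥0 zero)}} (c≤c′ zero))
             (weightedSum-mono (μ≥0 ∘ suc) (c≤c′ ∘ suc))

weightedSum-zero : ∀ {L} (μ : Fin L → ℚ) → weightedSum μ (λ _ → 0ℚ) ≡ 0ℚ
weightedSum-zero {zero}  μ = refl
weightedSum-zero {suc L} μ = cong₂ _+_ (ℚ.*-zeroʳ (μ zero)) (weightedSum-zero (μ ∘ suc))

weightedSum-one : ∀ {L} (μ : Fin L → ℚ) → weightedSum μ (λ _ → 1ℚ) ≡ sumFin μ
weightedSum-one {zero}  μ = refl
weightedSum-one {suc L} μ = cong₂ _+_ (ℚ.*-identityʳ (μ zero)) (weightedSum-one (μ ∘ suc))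

weightedSum-null : ∀ {L} {μ : Fin L → ℚ} (c : Fin L → ℚ) → (∀ j → μ j ≡ 0ℚ) →
                   weightedSum μ c ≡ 0ℚ
weightedSum-null {zero}  c μ≡0 = refl
weightedSum-null {suc L} c μ≡0 =
  cong₂ _+_ (trans (cong (_* c zero) (μ≡0 zero)) (ℚ.*-zeroˡ (c zero)))
            (weightedSum-null (c ∘ suc) (μ≡0 ∘ suc))

weightedSum-affine : ∀ {L} (μ : Fin L → ℚ) α β c →
                     weightedSum μ (λ j → α + β * c j) ≡ α * sumFin μ + β * weightedSum μ c
weightedSum-affine {zero}  μ α β c = solve 2 (λ α β → con 0ℚ := α :* con 0ℚ :+ β :* con 0ℚ) refl α β
weightedSum-affine {suc L} μ α β c =
  trans (cong (μ zero * (α + β * c zero) +_) (weightedSum-affine (μ ∘ suc) α β (c ∘ suc)))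
        (solve 6 (λ m α β c S W → m :* (α :+ β :* c) :+ (α :* S :+ β :* W)
                                  := α :* (m :+ S) :+ β :* (m :* c :+ W))
               refl (μ zero) α β (c zero) _ _)

convex-affine : ∀ {L} (μ : Fin L → ℚ) α β c → sumFin μ ≡ 1ℚ →
                weightedSum μ (λ j → α + β * c j) ≡ α + β * weightedSum μ c
convex-affine μ α β c Σμ≡1 =
  trans (weightedSum-affine μ α β c)
        (cong (_+ β * weightedSum μ c) (trans (cong (α *_) Σμ≡1) (ℚ.*-identityʳ α)))

lit-weightedSum : ∀ σ {L} (μ c : Fin L → ℚ) → sumFin μ ≡ 1ℚ →
                  lit σ (weightedSum μ c) ≡ weightedSum μ (λ j → lit σ (c j))
lit-weightedSum plus  _ _ _ = refl
lit-weightedSum minus μ c Σμ≡1 = begin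
  1ℚ - weightedSum μ c                  ≡⟨ complement (weightedSum μ c) ⟩
  1ℚ + - 1ℚ * weightedSum μ c           ≡⟨ sym (convex-affine μ 1ℚ (- 1ℚ) c Σμ≡1) ⟩
  weightedSum μ (λ j → 1ℚ + - 1ℚ * c j) ≡⟨ weightedSum-cong μ (sym ∘ complement ∘ c) ⟩
  weightedSum μ (λ j → 1ℚ - c j)        ∎
  where
  open ≡-Reasoning
  complement : ∀ q → 1ℚ - q ≡ 1ℚ + - 1ℚ * q
  complement = solve 1 (λ q → con 1ℚ :- q := con 1ℚ :+ con (- 1ℚ) :* q) refl

weightedSum-updateAt : ∀ {M} (w g : Fin M → ℚ) t →
                       weightedSum w g ≡ w t * g t + weightedSum (updateAt w t (λ _ → 0ℚ)) g
weightedSum-updateAt w g zero =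
  cong (w zero * g zero +_)
       (sym (trans (cong (_+ rest) (ℚ.*-zeroˡ (g zero))) (ℚ.+-identityˡ rest)))
  where
  rest : ℚ
  rest = weightedSum (w ∘ suc) (g ∘ suc)
weightedSum-updateAt w g (suc t) =
  trans (cong (w zero * g zero +_) (weightedSum-updateAt (w ∘ suc) (g ∘ suc) t))
        (solve 3 (λ a b c → a :+ (b :+ c) := b :+ (a :+ c)) refl (w zero * g zero) (w (suc t) * g (suc t)) rest)
  where
  rest : ℚ
  rest = weightedSum (updateAt (w ∘ suc) t (λ _ → 0ℚ)) (g ∘ suc)

lift-weights : ∀ {L M} (a : Fin L → Fin M) (w : Fin M → ℚ) →
               (∀ t → 0ℚ ≤ w t) → (∀ t → (∀ j → a j ≢ t) → w t ≡ 0ℚ) →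
               Σ (Fin L → ℚ) λ μ → (∀ j → 0ℚ ≤ μ j) ×
                                   (∀ g → weightedSum μ (g ∘ a) ≡ weightedSum w g)
lift-weights {zero} a w w≥0 support =
  (λ ()) , (λ ()) , λ g → sym (weightedSum-null g (λ t → support t (λ ())))
lift-weights {suc L} a w w≥0 support =
  let μ , μ≥0 , push = lift-weights (a ∘ suc) w′ w′≥0 w′-support in
  (w (a zero) ∷ μ) ,
  (λ { zero → w≥0 (a zero) ; (suc j) → μ≥0 j }) ,
  λ g → trans (cong (w (a zero) * g (a zero) +_) (push g)) (sym (weightedSum-updateAt w g (a zero)))
  where
  w′ : Fin _ → ℚ
  w′ = updateAt w (a zero) (λ _ → 0ℚ)

  w′≥0 : ∀ t → 0ℚ ≤ w′ t
  w′≥0 t with t Fin.≟ a zero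
  ... | yes refl = ℚ.≤-reflexive (sym (updateAt-updates (a zero) w))
  ... | no t≢a₀  = subst (0ℚ ≤_) (sym (updateAt-minimal t (a zero) w t≢a₀)) (w≥0 t)

  w′-support : ∀ t → (∀ j → a (suc j) ≢ t) → w′ t ≡ 0ℚ
  w′-support t missed with t Fin.≟ a zero
  ... | yes refl = updateAt-updates (a zero) w
  ... | no t≢a₀  = trans (updateAt-minimal t (a zero) w t≢a₀)
                         (support t λ { zero → t≢a₀ ∘ sym ; (suc j) → missed j })

-- Staircases: nonnegative combinations of unit steps

step : ℕ → ℕ → ℚ
step zero    k       = 1ℚ
step (suc t) zero    = 0ℚ
step (suc t) (suc k) = step t k

step-≤ : ∀ {t k} → t ℕ.≤ k → step t k ≡ 1ℚ
step-≤ z≤n       = refl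
step-≤ (s≤s t≤k) = step-≤ t≤k

step-≰ : ∀ {t k} → ¬ t ℕ.≤ k → step t k ≡ 0ℚ
step-≰ {zero}          t≰k = ⊥-elim (t≰k z≤n)
step-≰ {suc t} {zero}  _   = refl
step-≰ {suc t} {suc k} t≰k = step-≰ (t≰k ∘ s≤s)

0≤step : ∀ t k → 0ℚ ≤ step t k
0≤step zero    k       = ℚ.nonNegative⁻¹ 1ℚ
0≤step (suc t) zero    = ℚ.≤-refl
0≤step (suc t) (suc k) = 0≤step t k

step≤1 : ∀ t k → step t k ≤ 1ℚ
step≤1 zero    k       = ℚ.≤-refl
step≤1 (suc t) zero    = ℚ.nonNegative⁻¹ 1ℚ
step≤1 (suc t) (suc k) = step≤1 t k

step-mono : ∀ t {k k′} → k ℕ.≤ k′ → step t k ≤ step t k′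
step-mono zero    _                = ℚ.≤-refl
step-mono (suc t) {zero} {k′} _     = 0≤step (suc t) k′
step-mono (suc t) {suc k} (s≤s k≤k′) = step-mono t k≤k′

step-suc : ∀ {t k} → t ≢ k → step (suc t) k ≡ step t k
step-suc {zero}  {zero}  t≢k = ⊥-elim (t≢k refl)
step-suc {zero}  {suc k} _   = refl
step-suc {suc t} {zero}  _   = refl
step-suc {suc t} {suc k} t≢k = step-suc (t≢k ∘ cong suc)

telescope : ∀ {M} (H : ℕ → ℚ) {k} → k ℕ.< M →
            weightedSum {M} (λ t → H (suc (toℕ t)) - H (toℕ t)) (λ t → step (toℕ t) k) ≡ H (suc k) - H 0
telescope {suc M} H {zero} _ =
  trans (cong₂ _+_ (ℚ.*-identityʳ (H 1 - H 0)) (weightedSum-zero {M} later-jumps)) (ℚ.+-identityʳ (H 1 - H 0))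
  where
  later-jumps : Fin M → ℚ
  later-jumps t = H (suc (suc (toℕ t))) - H (suc (toℕ t))
telescope {suc M} H {suc k} (s≤s k<M) =
  trans (cong₂ _+_ (ℚ.*-identityʳ (H 1 - H 0)) (telescope (H ∘ suc) k<M))
        (solve 3 (λ h₀ h₁ h → (h₁ :- h₀) :+ (h :- h₁) := h :- h₀) refl (H 0) (H 1) (H (suc (suc k))))

staircase : ∀ {L M} → (Fin L → ℚ) → (Fin L → Fin M) → ℕ → ℚ
staircase μ a k = weightedSum μ (λ j → step (toℕ (a j)) k)

staircase-mono : ∀ {L M} {μ : Fin L → ℚ} (a : Fin L → Fin M) → (∀ j → 0ℚ ≤ μ j) →
                 ∀ {k k′} → k ℕ.≤ k′ → staircase μ a k ≤ staircase μ a k′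
staircase-mono a μ≥0 k≤k′ = weightedSum-mono μ≥0 (λ j → step-mono (toℕ (a j)) k≤k′)

staircase-bounds : ∀ {L M} {μ : Fin L → ℚ} (a : Fin L → Fin M) → (∀ j → 0ℚ ≤ μ j) →
                   sumFin μ ≡ 1ℚ → ∀ k → 0ℚ ≤ staircase μ a k × staircase μ a k ≤ 1ℚ
staircase-bounds {μ = μ} a μ≥0 Σμ≡1 k =
  subst (_≤ staircase μ a k) (weightedSum-zero μ)
        (weightedSum-mono μ≥0 (λ j → 0≤step (toℕ (a j)) k)) ,
  subst (staircase μ a k ≤_) (trans (weightedSum-one μ) Σμ≡1)
        (weightedSum-mono μ≥0 (λ j → step≤1 (toℕ (a j)) k))

staircase-top : ∀ {L M} (μ : Fin L → ℚ) (a : Fin L → Fin (suc M)) → staircase μ a M ≡ sumFin μ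
staircase-top μ a = trans (weightedSum-cong μ (λ j → step-≤ (Fin.toℕ≤pred[n] (a j)))) (weightedSum-one μ)

staircase-flat : ∀ {L M} (μ : Fin L → ℚ) (a : Fin L → Fin M) {t} → (∀ j → a j ≢ t) →
                 staircase μ (Fin.suc ∘ a) (toℕ t) ≡ staircase μ a (toℕ t)
staircase-flat μ a a≢t = weightedSum-cong μ (λ j → step-suc (a≢t j ∘ Fin.toℕ-injective))

-- The weights are the jumps of z, which vanish away from the image of a.
staircase-decomposition :
  ∀ {L M} (a : Fin L → Fin M) (z : ℕ → ℚ) →
  (∀ t → z (toℕ t) ≤ z (suc (toℕ t))) →
  (∀ t → (∀ j → a j ≢ t) → z (toℕ t) ≡ z (suc (toℕ t))) →
  Σ (Fin L → ℚ) λ μ → (∀ j → 0ℚ ≤ μ j) ×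
                      (∀ {k} → k ℕ.< M → staircase μ a k ≡ z (suc k) - z 0)
staircase-decomposition a z rising flat =
  let μ , μ≥0 , push = lift-weights a jump (0≤q-p ∘ rising) no-jump in
  μ , μ≥0 , λ k<M → trans (push (λ t → step (toℕ t) _)) (telescope z k<M)
  where
  jump : Fin _ → ℚ
  jump t = z (suc (toℕ t)) - z (toℕ t)

  no-jump : ∀ t → (∀ j → a j ≢ t) → jump t ≡ 0ℚ
  no-jump t a≢t = trans (cong (_- z (toℕ t)) (sym (flat t a≢t))) (ℚ.+-inverseʳ (z (toℕ t)))

-- Sorting by a total preorder, and thresholds of monotone predicates

module _ {A : Set} {_≲_ : A → A → Set} (≲-total : Total _≲_) (≲-trans : Transitive _≲_) where

  ≲-refl : ∀ a → a ≲ a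
  ≲-refl a = Sum.reduce (≲-total a a)

  minimum : ∀ {m} (f : Fin (suc m) → A) → Σ (Fin (suc m)) λ i₀ → ∀ i → f i₀ ≲ f i
  minimum {zero}  f = zero , λ { zero → ≲-refl (f zero) }
  minimum {suc m} f with minimum (f ∘ suc)
  ... | i₁ , i₁-min with ≲-total (f zero) (f (suc i₁))
  ...   | inj₁ f₀≲ = zero , λ { zero → ≲-refl (f zero) ; (suc i) → ≲-trans f₀≲ (i₁-min i) }
  ...   | inj₂ ≲f₀ = suc i₁ , λ { zero → ≲f₀ ; (suc i) → i₁-min i }

  sortingPermutation : ∀ {m} (f : Fin (suc m) → A) →
    Σ (Permutation′ (suc m)) λ p → ∀ (i : Fin m) → f (p ⟨$⟩ʳ inject₁ i) ≲ f (p ⟨$⟩ʳ suc i)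
  sortingPermutation {zero}  f = Permutation.id , λ ()
  sortingPermutation {suc m} f with minimum f
  ... | i₀ , i₀-min with sortingPermutation (f ∘ punchIn i₀)
  ...   | p , p-sorted = insert zero i₀ p , λ where
    zero    → subst (λ j → f i₀ ≲ f j) (sym (insert-punchIn zero i₀ p zero)) (i₀-min _)
    (suc i) → subst₂ (λ u v → f u ≲ f v) (sym (insert-punchIn zero i₀ p (inject₁ i)))
                     (sym (insert-punchIn zero i₀ p (suc i))) (p-sorted i)

upward-closed : ∀ {m} {P : Fin (suc m) → Set} → (∀ (i : Fin m) → P (inject₁ i) → P (suc i)) →
                P zero → ∀ k → P k
upward-closed           adj P₀ zero    = P₀
upward-closed {suc m} {P} adj P₀ (suc k) =
  upward-closed {P = P ∘ suc} (adj ∘ suc) (adj zero P₀) k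

threshold : ∀ {m} {P : Fin (suc m) → Set} → Decidable P →
            (∀ (i : Fin m) → P (inject₁ i) → P (suc i)) →
            Σ (Fin (suc (suc m))) λ a → ∀ k → P k ⇔ toℕ a ℕ.≤ toℕ k
threshold P? adj with P? zero
... | yes P₀ = zero , λ k → mk⇔ (λ _ → z≤n) (λ _ → upward-closed adj P₀ k)
threshold {zero}  P? adj | no ¬P₀ = suc zero , λ { zero → mk⇔ (⊥-elim ∘ ¬P₀) λ () }
threshold {suc m} P? adj | no ¬P₀ =
  let a , a-spec = threshold (P? ∘ suc) (adj ∘ suc) in
  suc a , λ { zero    → mk⇔ (⊥-elim ∘ ¬P₀) λ ()
            ; (suc k) → mk⇔ (s≤s ∘ to (a-spec k)) (from (a-spec k) ∘ s≤s⁻¹) }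

-- Ladder ½ e (λ k → lit (s k) (x (p ⟨$⟩ʳ k))) unfolds to System p e s x; the lower end b
-- is general so that ladder⇔steps can be proved by induction.

Ladder : ∀ {m} → ℚ → (Fin (suc (suc m)) → Rel) → (Fin (suc m) → ℚ) → Set
Ladder {m} b e y =
  holds (e zero) b (y zero) ×
  (∀ (i : Fin m) → holds (e (suc (inject₁ i))) (y (inject₁ i)) (y (suc i))) ×
  holds (e (fromℕ (suc m))) (y (fromℕ m)) 1ℚ

Steps : ∀ {M} → (Fin M → Rel) → (ℕ → ℚ) → Set
Steps e z = ∀ t → holds (e t) (z (toℕ t)) (z (suc (toℕ t)))

ladder⇔steps : ∀ {m b} {e : Fin (suc (suc m)) → Rel} {y : Fin (suc m) → ℚ} (z : ℕ → ℚ) →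
               z 0 ≡ b → (∀ k → z (suc (toℕ k)) ≡ y k) → z (suc (suc m)) ≡ 1ℚ →
               Ladder b e y ⇔ Steps e z
ladder⇔steps {zero} {e = e} z z₀ zₖ z₂ = mk⇔
  (λ { (h₀ , _ , h₁) → λ { zero       → holds-cong (e zero) (sym z₀) (sym (zₖ zero)) h₀
                         ; (suc zero) → holds-cong (e (suc zero)) (sym (zₖ zero)) (sym z₂) h₁ } })
  (λ st → holds-cong (e zero) z₀ (zₖ zero) (st zero) , (λ ()) ,
          holds-cong (e (suc zero)) (zₖ zero) z₂ (st (suc zero)))
ladder⇔steps {suc m} {e = e} {y} z z₀ zₖ z₂ = mk⇔
  (λ { (h₀ , h₁ , h₂) → λ { zero    → holds-cong (e zero) (sym z₀) (sym (zₖ zero)) h₀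
                          ; (suc t) → to shifted (h₁ zero , h₁ ∘ suc , h₂) t } })
  (λ st → let h₁ , h₁′ , h₂ = from shifted (st ∘ suc) in
          holds-cong (e zero) z₀ (zₖ zero) (st zero) , (λ { zero → h₁ ; (suc i) → h₁′ i }) , h₂)
  where
  shifted : Ladder (y zero) (e ∘ suc) (y ∘ suc) ⇔ Steps (e ∘ suc) (z ∘ suc)
  shifted = ladder⇔steps {m} {e = e ∘ suc} (z ∘ suc) (zₖ zero) (zₖ ∘ suc) z₂

extendByOne : ∀ {n} → (Fin n → ℚ) → ℕ → ℚ
extendByOne {zero}  y t       = 1ℚ
extendByOne {suc n} y zero    = y zero
extendByOne {suc n} y (suc t) = extendByOne (y ∘ suc) t

extendByOne-toℕ : ∀ {n} (y : Fin n → ℚ) k → extendByOne y (toℕ k) ≡ y k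
extendByOne-toℕ y zero    = refl
extendByOne-toℕ y (suc k) = extendByOne-toℕ (y ∘ suc) k

extendByOne-end : ∀ {n} (y : Fin n → ℚ) → extendByOne y n ≡ 1ℚ
extendByOne-end {zero}  y = refl
extendByOne-end {suc n} y = extendByOne-end (y ∘ suc)

rungs : ∀ {n} → ℚ → (Fin n → ℚ) → ℕ → ℚ
rungs b y zero    = b
rungs b y (suc t) = extendByOne y t

ladder⇔rungs : ∀ {m b} {e : Fin (suc (suc m)) → Rel} {y : Fin (suc m) → ℚ} →
               Ladder b e y ⇔ Steps e (rungs b y)
ladder⇔rungs {y = y} = ladder⇔steps (rungs _ y) refl (extendByOne-toℕ y) (extendByOne-end y)

-- Literals over an ascending sequence in [½, 1]

record Ascending {k : ℕ} (y : Fin k → ℚ) : Set where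
  field
    lower : ∀ i → ½ ≤ y i
    upper : ∀ i → y i ≤ 1ℚ
    mono  : ∀ {i j} → i Fin.≤ j → y i ≤ y j

data Literal (k : ℕ) : Set where
  0ₗ 1ₗ   : Literal k
  pos neg : Fin k → Literal k

⟦_⟧ : ∀ {k} → Literal k → (Fin k → ℚ) → ℚ
⟦ 0ₗ    ⟧ y = 0ℚ
⟦ 1ₗ    ⟧ y = 1ℚ
⟦ pos i ⟧ y = y i
⟦ neg i ⟧ y = 1ℚ - y i

signed : ∀ {k} → Sign → Fin k → Literal k
signed plus  i = pos i
signed minus i = neg i

⟦signed⟧ : ∀ {k} σ i (y : Fin k → ℚ) → ⟦ signed σ i ⟧ y ≡ lit σ (y i)
⟦signed⟧ plus  i y = refl
⟦signed⟧ minus i y = refl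

¬ₗ_ : ∀ {k} → Literal k → Literal k
¬ₗ 0ₗ    = 1ₗ
¬ₗ 1ₗ    = 0ₗ
¬ₗ pos i = neg i
¬ₗ neg i = pos i

⟦¬ₗ⟧ : ∀ {k} d (y : Fin k → ℚ) → ⟦ ¬ₗ d ⟧ y ≡ 1ℚ - ⟦ d ⟧ y
⟦¬ₗ⟧ 0ₗ      y = refl
⟦¬ₗ⟧ 1ₗ      y = refl
⟦¬ₗ⟧ (pos i) y = refl
⟦¬ₗ⟧ (neg i) y = sym (lit-involutive minus (y i))

data _≤ₗ_ {k} : Literal k → Literal k → Set where
  0ₗ≤     : ∀ {d} → 0ₗ ≤ₗ d
  ≤1ₗ     : ∀ {d} → d ≤ₗ 1ₗ
  neg≤pos : ∀ {i j} → neg i ≤ₗ pos j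
  pos≤pos : ∀ {i j} → i Fin.≤ j → pos i ≤ₗ pos j
  neg≤neg : ∀ {i j} → j Fin.≤ i → neg i ≤ₗ neg j

≤ₗ-total : ∀ {k} → Total (_≤ₗ_ {k})
≤ₗ-total 0ₗ      d       = inj₁ 0ₗ≤
≤ₗ-total d       0ₗ      = inj₂ 0ₗ≤
≤ₗ-total 1ₗ      d       = inj₂ ≤1ₗ
≤ₗ-total d       1ₗ      = inj₁ ≤1ₗ
≤ₗ-total (pos i) (pos j) = Sum.map pos≤pos pos≤pos (Fin.≤-total i j)
≤ₗ-total (pos i) (neg j) = inj₂ neg≤pos
≤ₗ-total (neg i) (pos j) = inj₁ neg≤pos
≤ₗ-total (neg i) (neg j) = Sum.map neg≤neg neg≤neg (Fin.≤-total j i)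

≤ₗ-sound : ∀ {k} {y : Fin k → ℚ} → Ascending y → ∀ {d d′} → d ≤ₗ d′ → ⟦ d ⟧ y ≤ ⟦ d′ ⟧ y
≤ₗ-sound asc (0ₗ≤ {0ₗ})    = ℚ.≤-refl
≤ₗ-sound asc (0ₗ≤ {1ₗ})    = ℚ.nonNegative⁻¹ 1ℚ
≤ₗ-sound asc (0ₗ≤ {pos i}) = ℚ.≤-trans 0≤½ (Ascending.lower asc i)
≤ₗ-sound asc (0ₗ≤ {neg i}) = 0≤q-p (Ascending.upper asc i)
≤ₗ-sound asc (≤1ₗ {0ₗ})    = ℚ.nonNegative⁻¹ 1ℚ
≤ₗ-sound asc (≤1ₗ {1ₗ})    = ℚ.≤-refl
≤ₗ-sound asc (≤1ₗ {pos i}) = Ascending.upper asc i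
≤ₗ-sound asc (≤1ₗ {neg i}) = ℚ.≤-trans (1-antimono (Ascending.lower asc i)) ½≤1
≤ₗ-sound asc (neg≤pos {i} {j}) = ℚ.≤-trans (1-antimono (Ascending.lower asc i)) (Ascending.lower asc j)
≤ₗ-sound asc (pos≤pos i≤j) = Ascending.mono asc i≤j
≤ₗ-sound asc (neg≤neg j≤i) = 1-antimono (Ascending.mono asc j≤i)

_∨ₗ_ : ∀ {k} → Literal k → Literal k → Literal k
d ∨ₗ d′ with ≤ₗ-total d d′
... | inj₁ _ = d′
... | inj₂ _ = d

_∧ₗ_ : ∀ {k} → Literal k → Literal k → Literal k
d ∧ₗ d′ with ≤ₗ-total d d′
... | inj₁ _ = d
... | inj₂ _ = d′

⟦∨ₗ⟧ : ∀ {k} {y : Fin k → ℚ} → Ascending y → ∀ d d′ → ⟦ d ∨ₗ d′ ⟧ y ≡ ⟦ d ⟧ y ⊔ ⟦ d′ ⟧ y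
⟦∨ₗ⟧ asc d d′ with ≤ₗ-total d d′
... | inj₁ d≤d′ = sym (ℚ.p≤q⇒p⊔q≡q (≤ₗ-sound asc d≤d′))
... | inj₂ d′≤d = sym (ℚ.p≥q⇒p⊔q≡p (≤ₗ-sound asc d′≤d))

⟦∧ₗ⟧ : ∀ {k} {y : Fin k → ℚ} → Ascending y → ∀ d d′ → ⟦ d ∧ₗ d′ ⟧ y ≡ ⟦ d ⟧ y ⊓ ⟦ d′ ⟧ y
⟦∧ₗ⟧ asc d d′ with ≤ₗ-total d d′
... | inj₁ d≤d′ = sym (ℚ.p≤q⇒p⊓q≡p (≤ₗ-sound asc d≤d′))
... | inj₂ d′≤d = sym (ℚ.p≥q⇒p⊓q≡q (≤ₗ-sound asc d′≤d))

module KleeneDenotation {n k : ℕ} (S : Point n → Set) (y : Point n → Fin k → ℚ)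
                        (ascending : ∀ {x} → S x → Ascending (y x))
                        (atom : Fin n → Literal k) (atom-value : ∀ x i → ⟦ atom i ⟧ (y x) ≡ x i) where

  denote : KTerm n → Literal k
  denote (proj i)   = atom i
  denote zeroT      = 0ₗ
  denote oneT       = 1ₗ
  denote (maxT t u) = denote t ∨ₗ denote u
  denote (minT t u) = denote t ∧ₗ denote u
  denote (negT t)   = ¬ₗ denote t

  eval-denote : ∀ t {x} → S x → eval t x ≡ ⟦ denote t ⟧ (y x)
  eval-denote (proj i)   {x} _ = sym (atom-value x i)
  eval-denote zeroT          _ = refl
  eval-denote oneT           _ = refl
  eval-denote (maxT t u) x∈S = trans (cong₂ _⊔_ (eval-denote t x∈S) (eval-denote u x∈S))
                                     (sym (⟦∨ₗ⟧ (ascending x∈S) (denote t) (denote u)))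
  eval-denote (minT t u) x∈S = trans (cong₂ _⊓_ (eval-denote t x∈S) (eval-denote u x∈S))
                                     (sym (⟦∧ₗ⟧ (ascending x∈S) (denote t) (denote u)))
  eval-denote (negT t)   x∈S = trans (cong (λ q → 1ℚ - q) (eval-denote t x∈S)) (sym (⟦¬ₗ⟧ (denote t) _))

LiteralOn : ∀ {n} → (Point n → Set) → (Point n → ℚ) → Set
LiteralOn S f =
  (∀ x → S x → f x ≡ 0ℚ) ⊎ (∀ x → S x → f x ≡ 1ℚ) ⊎
  (∃ λ i → (∀ x → S x → f x ≡ x i) ⊎ (∀ x → S x → f x ≡ 1ℚ - x i))

LiteralOn-cong : ∀ {n} {S : Point n → Set} {f g : Point n → ℚ} →
                 (∀ x → S x → f x ≡ g x) → LiteralOn S g → LiteralOn S f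
LiteralOn-cong f≡g (inj₁ g≡0) =
  inj₁ λ x x∈S → trans (f≡g x x∈S) (g≡0 x x∈S)
LiteralOn-cong f≡g (inj₂ (inj₁ g≡1)) =
  inj₂ (inj₁ λ x x∈S → trans (f≡g x x∈S) (g≡1 x x∈S))
LiteralOn-cong f≡g (inj₂ (inj₂ (i , inj₁ g≡xᵢ))) =
  inj₂ (inj₂ (i , inj₁ λ x x∈S → trans (f≡g x x∈S) (g≡xᵢ x x∈S)))
LiteralOn-cong f≡g (inj₂ (inj₂ (i , inj₂ g≡1-xᵢ))) =
  inj₂ (inj₂ (i , inj₂ λ x x∈S → trans (f≡g x x∈S) (g≡1-xᵢ x x∈S)))

literalOn-lit : ∀ {n} {S : Point n → Set} σ i → LiteralOn S (λ x → lit σ (x i))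
literalOn-lit plus  i = inj₂ (inj₂ (i , inj₁ λ _ _ → refl))
literalOn-lit minus i = inj₂ (inj₂ (i , inj₂ λ _ _ → refl))

literalOn-colit : ∀ {n} {S : Point n → Set} σ i → LiteralOn S (λ x → 1ℚ - lit σ (x i))
literalOn-colit plus  i = inj₂ (inj₂ (i , inj₂ λ _ _ → refl))
literalOn-colit minus i = inj₂ (inj₂ (i , inj₁ λ x _ → lit-involutive minus (x i)))

_≟ₖ_ : DecidableEquality K3
k0 ≟ₖ k0 = yes refl
k0 ≟ₖ kh = no λ ()
k0 ≟ₖ k1 = no λ ()
kh ≟ₖ k0 = no λ ()
kh ≟ₖ kh = yes refl
kh ≟ₖ k1 = no λ ()
k1 ≟ₖ k0 = no λ ()
k1 ≟ₖ kh = no λ ()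
k1 ≟ₖ k1 = yes refl

≼-sharp : ∀ {u v} → u ≼ v → u ≢ kh → v ≡ u
≼-sharp ≼-refl _    = refl
≼-sharp ≼-half u≢kh = ⊥-elim (u≢kh refl)

0⋠1 : ¬ (k0 ≼ k1)
0⋠1 ()

1⋠0 : ¬ (k1 ≼ k0)
1⋠0 ()

-- A simplex of the Kleene triangulation

module Simplex {m : ℕ} (C : List (Vertex (suc m))) (C-chain : IsChain C) where

  V : Fin (length C) → Vertex (suc m)
  V = lookup C

  no-opposite-coordinates : ∀ {j j′ i} → V j i ≡ k0 → V j′ i ≡ k1 → ⊥
  no-opposite-coordinates {j} {j′} {i} Vji≡0 Vj′i≡1 = Sum.[
    (λ Vj≼Vj′ → 0⋠1 (subst₂ _≼_ Vji≡0 Vj′i≡1 (Vj≼Vj′ i))) ,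
    (λ Vj′≼Vj → 1⋠0 (subst₂ _≼_ Vj′i≡1 Vji≡0 (Vj′≼Vj i))) ]′ (C-chain j j′)

  _⊑_ : Fin (suc m) → Fin (suc m) → Set
  i ⊑ i′ = ∀ j → V j i ≢ kh → V j i′ ≢ kh

  ⊑-trans : Transitive _⊑_
  ⊑-trans i⊑i′ i′⊑i″ j = i′⊑i″ j ∘ i⊑i′ j

  ⊑-total : Total _⊑_
  ⊑-total i i′ with any? (λ j → ¬? (V j i ≟ₖ kh) ×-dec (V j i′ ≟ₖ kh))
  ... | no none = inj₁ λ j sharp half → none (j , sharp , half)
  ... | yes (j , sharp , half) = inj₂ λ j′ sharp′ → Sum.[
    (λ Vj≼Vj′ → sharp ∘ trans (sym (≼-sharp (Vj≼Vj′ i) sharp))) ,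
    (λ Vj′≼Vj → ⊥-elim (sharp′ (trans (sym (≼-sharp (Vj′≼Vj i′) sharp′)) half)))
    ]′ (C-chain j j′)

  sorted : Σ (Permutation′ (suc m)) λ p → ∀ (i : Fin m) → (p ⟨$⟩ʳ inject₁ i) ⊑ (p ⟨$⟩ʳ suc i)
  sorted = sortingPermutation ⊑-total ⊑-trans (λ i → i)

  order : Permutation′ (suc m)
  order = proj₁ sorted

  π : Fin (suc m) → Fin (suc m)
  π k = order ⟨$⟩ʳ k

  rank-spec : ∀ j → Σ (Fin (suc (suc m))) λ r → ∀ k → V j (π k) ≢ kh ⇔ toℕ r ℕ.≤ toℕ k
  rank-spec j = threshold (λ k → ¬? (V j (π k) ≟ₖ kh)) (λ i → proj₂ sorted i j)

  rank : Fin (length C) → Fin (suc (suc m))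
  rank j = proj₁ (rank-spec j)

  s : Fin (suc m) → Sign
  s k = signFor (any? λ j → V j (π k) ≟ₖ k0)

  e : Fin (suc (suc m)) → Rel
  e t = relationFor (any? λ j → rank j Fin.≟ t)

  y : Point (suc m) → Fin (suc m) → ℚ
  y x k = lit (s k) (x (π k))

  x-from-y : ∀ x i → lit (s (order ⟨$⟩ˡ i)) (y x (order ⟨$⟩ˡ i)) ≡ x i
  x-from-y x i = trans (lit-involutive (s k) (x (π k))) (cong x (inverseʳ order))
    where
    k : Fin (suc m)
    k = order ⟨$⟩ˡ i

  signed-sharp : ∀ j k → V j (π k) ≢ kh → lit (s k) (toℚ (V j (π k))) ≡ 1ℚ
  signed-sharp j k sharp with V j (π k) in Vjπk | any? (λ j′ → V j′ (π k) ≟ₖ k0)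
  ... | k0 | yes _            = refl
  ... | k0 | no none          = ⊥-elim (none (j , Vjπk))
  ... | k1 | no _             = refl
  ... | k1 | yes (j′ , Vj′≡0) = ⊥-elim (no-opposite-coordinates Vj′≡0 Vjπk)
  ... | kh | _                = ⊥-elim (sharp refl)

  sharp⇔rank≤ : ∀ j k → V j (π k) ≢ kh ⇔ toℕ (rank j) ℕ.≤ toℕ k
  sharp⇔rank≤ j = proj₂ (rank-spec j)

  vertex-coordinate : ∀ j k → lit (s k) (toℚ (V j (π k))) ≡ ½ + ½ * step (toℕ (rank j)) (toℕ k)
  vertex-coordinate j k with V j (π k) ≟ₖ kh
  ... | yes half = begin
    lit (s k) (toℚ (V j (π k)))          ≡⟨ cong (lit (s k) ∘ toℚ) half ⟩
    lit (s k) ½                          ≡⟨ lit-half (s k) ⟩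
    ½ + ½ * 0ℚ                           ≡⟨ cong (λ q → ½ + ½ * q) (sym (step-≰ rank≰k)) ⟩
    ½ + ½ * step (toℕ (rank j)) (toℕ k)  ∎
    where
    open ≡-Reasoning
    rank≰k : ¬ toℕ (rank j) ℕ.≤ toℕ k
    rank≰k rank≤k = from (sharp⇔rank≤ j k) rank≤k half
  ... | no sharp = trans (signed-sharp j k sharp)
                         (cong (λ q → ½ + ½ * q) (sym (step-≤ (to (sharp⇔rank≤ j k) sharp))))

  signed-combination : ∀ (μ : Fin (length C) → ℚ) → sumFin μ ≡ 1ℚ → ∀ k →
    lit (s k) (weightedSum μ (λ j → toℚ (V j (π k)))) ≡ ½ + ½ * staircase μ rank (toℕ k)
  signed-combination μ Σμ≡1 k = begin
    lit (s k) (weightedSum μ (λ j → toℚ (V j (π k))))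
      ≡⟨ lit-weightedSum (s k) μ (λ j → toℚ (V j (π k))) Σμ≡1 ⟩
    weightedSum μ (λ j → lit (s k) (toℚ (V j (π k))))
      ≡⟨ weightedSum-cong μ (λ j → vertex-coordinate j k) ⟩
    weightedSum μ (λ j → ½ + ½ * step (toℕ (rank j)) (toℕ k))
      ≡⟨ convex-affine μ ½ ½ (λ j → step (toℕ (rank j)) (toℕ k)) Σμ≡1 ⟩
    ½ + ½ * staircase μ rank (toℕ k) ∎
    where open ≡-Reasoning

  module FromCombination {x : Point (suc m)} {μ : Fin (length C) → ℚ}
    (μ≥0 : ∀ j → 0ℚ ≤ μ j) (Σμ≡1 : sumFin μ ≡ 1ℚ)
    (x≡ : ∀ i → x i ≡ weightedSum μ (λ j → toℚ (V j i))) where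

    y≡ : ∀ k → y x k ≡ ½ + ½ * staircase μ rank (toℕ k)
    y≡ k = trans (cong (lit (s k)) (x≡ (π k))) (signed-combination μ Σμ≡1 k)

    ascending : Ascending (y x)
    ascending = record
      { lower = λ k → subst (½ ≤_) (sym (y≡ k)) (½+½*-mono (proj₁ (bounds k)))
      ; upper = λ k → subst (_≤ 1ℚ) (sym (y≡ k)) (½+½*-mono (proj₂ (bounds k)))
      ; mono  = λ k≤k′ → subst₂ _≤_ (sym (y≡ _)) (sym (y≡ _))
                                    (½+½*-mono (staircase-mono rank μ≥0 k≤k′))
      }
      where
      bounds : ∀ k → 0ℚ ≤ staircase μ rank (toℕ k) × staircase μ rank (toℕ k) ≤ 1ℚ
      bounds k = staircase-bounds rank μ≥0 Σμ≡1 (toℕ k)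

    inCube : InCube x
    inCube i = subst (λ q → 0ℚ ≤ q × q ≤ 1ℚ) (x-from-y x i)
                     (lit-unit-interval (s k) (Ascending.lower ascending k) (Ascending.upper ascending k))
      where
      k : Fin (suc m)
      k = order ⟨$⟩ˡ i

    -- Shifting the ranks by one makes z 0 = ½ and z (suc k) = y x k.
    ladder : Ladder ½ e (y x)
    ladder = from (ladder⇔steps z (cong (λ q → ½ + ½ * q) (weightedSum-zero μ)) (sym ∘ y≡)
                                  (cong (λ q → ½ + ½ * q) (trans (staircase-top μ rank) Σμ≡1)))
                  steps
      where
      z : ℕ → ℚ
      z t = ½ + ½ * staircase μ (Fin.suc ∘ rank) t
      steps : Steps e z
      steps t = holds-relationFor (any? λ j → rank j Fin.≟ t)
        (λ _ → ½+½*-mono (staircase-mono (Fin.suc ∘ rank) μ≥0 (ℕ.n≤1+n (toℕ t))))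
        (λ missed → cong (λ q → ½ + ½ * q) (staircase-flat μ rank (λ j rⱼ≡t → missed (j , rⱼ≡t))))

  module FromLadder {x : Point (suc m)} (ladder : Ladder ½ e (y x)) where
    z : ℕ → ℚ
    z = rungs ½ (y x)

    steps : Steps e z
    steps = to ladder⇔rungs ladder

    rising : ∀ t → z (toℕ t) + z (toℕ t) ≤ z (suc (toℕ t)) + z (suc (toℕ t))
    rising t = let z≤z′ = holds⇒≤ (e t) (steps t) in ℚ.+-mono-≤ z≤z′ z≤z′

    flat : ∀ t → (∀ j → rank j ≢ t) → z (toℕ t) + z (toℕ t) ≡ z (suc (toℕ t)) + z (suc (toℕ t))
    flat t missed =
      let z≡z′ = relationFor-flat (any? λ j → rank j Fin.≟ t) (λ (j , rⱼ≡t) → missed j rⱼ≡t)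
                                  (steps t)
      in cong₂ _+_ z≡z′ z≡z′

    module Combination {μ : Fin (length C) → ℚ}
      (stair : ∀ {k} → k ℕ.< suc (suc m) → staircase μ rank k ≡ z (suc k) + z (suc k) - (½ + ½)) where

      Σμ≡1 : sumFin μ ≡ 1ℚ
      Σμ≡1 = trans (sym (staircase-top μ rank))
                   (trans (stair (ℕ.n<1+n (suc m))) (cong (λ q → q + q - (½ + ½)) (extendByOne-end (y x))))

      y≡ : ∀ k → y x k ≡ ½ + ½ * staircase μ rank (toℕ k)
      y≡ k = begin
        y x k
          ≡⟨ solve 1 (λ q → q := con ½ :+ con ½ :* (q :+ q :- (con ½ :+ con ½))) refl (y x k) ⟩
        ½ + ½ * (y x k + y x k - (½ + ½))
          ≡⟨ cong (λ q → ½ + ½ * (q + q - (½ + ½))) (sym (extendByOne-toℕ (y x) k)) ⟩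
        ½ + ½ * (z (suc (toℕ k)) + z (suc (toℕ k)) - (½ + ½))
          ≡⟨ cong (λ q → ½ + ½ * q) (sym (stair (ℕ.m≤n⇒m≤1+n (Fin.toℕ<n k)))) ⟩
        ½ + ½ * staircase μ rank (toℕ k) ∎
        where open ≡-Reasoning

      x≡ : ∀ i → x i ≡ weightedSum μ (λ j → toℚ (V j i))
      x≡ i = subst (λ i → x i ≡ weightedSum μ (λ j → toℚ (V j i))) (inverseʳ order)
                   (at (order ⟨$⟩ˡ i))
        where
        at : ∀ k → x (π k) ≡ weightedSum μ (λ j → toℚ (V j (π k)))
        at k = lit-injective (s k) (trans (y≡ k) (sym (signed-combination μ Σμ≡1 k)))

    -- Doubling the rungs, whose jumps add up to ½, gives weights that add up to 1.
    inConv : InConv C x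
    inConv =
      let μ , μ≥0 , stair = staircase-decomposition rank (λ u → z u + z u) rising flat
      in μ , μ≥0 , Combination.Σμ≡1 {μ} stair , Combination.x≡ {μ} stair

  convex⇔ladder : ∀ x → InConv C x ⇔ (InCube x × Ladder ½ e (y x))
  convex⇔ladder x = mk⇔
    (λ (_ , μ≥0 , Σμ≡1 , x≡) → let open FromCombination μ≥0 Σμ≡1 x≡ in inCube , ladder)
    (λ (_ , ladder) → FromLadder.inConv ladder)

  atom : Fin (suc m) → Literal (suc m)
  atom i = signed (s (order ⟨$⟩ˡ i)) (order ⟨$⟩ˡ i)

  open KleeneDenotation (InConv C) y (λ (_ , μ≥0 , Σμ≡1 , x≡) → FromCombination.ascending μ≥0 Σμ≡1 x≡)
    atom
    (λ x i → trans (⟦signed⟧ (s (order ⟨$⟩ˡ i)) (order ⟨$⟩ˡ i) (y x)) (x-from-y x i))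

  literal-on-simplex : ∀ d → LiteralOn (InConv C) (λ x → ⟦ d ⟧ (y x))
  literal-on-simplex 0ₗ      = inj₁ λ _ _ → refl
  literal-on-simplex 1ₗ      = inj₂ (inj₁ λ _ _ → refl)
  literal-on-simplex (pos k) = literalOn-lit (s k) (π k)
  literal-on-simplex (neg k) = literalOn-colit (s k) (π k)

  term-literal : ∀ t → LiteralOn (InConv C) (eval t)
  term-literal t = LiteralOn-cong (λ _ x∈σ → eval-denote t x∈σ) (literal-on-simplex (denote t))

lemma3p6 : (m : ℕ) (C : List (Vertex (suc m))) → IsChain C →
    (Σ (Permutation′ (suc m)) λ p → Σ (Fin (suc (suc m)) → Rel) λ e → Σ (Fin (suc m) → Sign) λ s →
      ∀ (x : Point (suc m)) → InConv C x ⇔ (InCube x × System p e s x))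
    × (∀ (t : KTerm (suc m)) →
         (∀ x → InConv C x → eval t x ≡ 0ℚ)
         ⊎ (∀ x → InConv C x → eval t x ≡ 1ℚ)
         ⊎ (∃ λ (i : Fin (suc m)) →
              (∀ x → InConv C x → eval t x ≡ x i)
              ⊎ (∀ x → InConv C x → eval t x ≡ 1ℚ - x i)))
lemma3p6 m C C-chain = (order , e , s , convex⇔ladder) , term-literal
  where open Simplex C C-chain
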